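{- Let $w \in \mathfrak{S}_n$ and $k \in [1,n-1]$. If $\max_k(w) = 1$, then $w$ has no occurrence of the pattern $3412$ that straddles $k$ in position, no occurrence of $3412$ that straddles $k$ in value, and no occurrence of $321$ that straddles $k$ both in position and in value.
   Context: $\mathfrak{S}_n$ is the symmetric group on $[1,n]$, written in one-line notation $w=w(1)w(2)\cdots w(n)$; $\sigma_i$ is the simple reflection exchanging $i$ and $i+1$. $\max_k(w)$ is the maximum, over all reduced decompositions (minimal-length expressions as products of simple reflections) of $w$, of the number of occurrences of the factor $\sigma_k$. An occurrence of $321$ in $w$ is a triple of positions $i_1<i_2<i_3$ with $w(i_1)>w(i_2)>w(i_3)$; an occurrence of $3412$ is a quadruple of positions $i_1<i_2<i_3<i_4$ with $w(i_3)<w(i_4)<w(i_1)<w(i_2)$. A $321$-occurrence in positions $i_1<i_2<i_3$ straddles $k$ in position if $i_1\le k<i_3$; a $321$-occurrence with values $j_1<j_2<j_3$ straddles $k$ in value if $j_1\le k<j_3$. A $3412$-occurrence in positions $i_1<i_2<i_3<i_4$ straddles $k$ in position if $i_2\le k<i_3$; a $3412$-occurrence with values $j_1<j_2<j_3<j_4$ straddles $k$ in value if $j_2\le k<j_3$. -}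

module Defs where

open import Data.Nat using (ℕ; zero; suc; _≤_; _<_)
open import Data.Fin using (Fin; toℕ; inject₁) renaming (suc to fsuc)
open import Data.Fin.Permutation using (Permutation′; transpose; _⟨$⟩ʳ_)
open import Data.List using (List; []; _∷_; length; filter)
open import Data.Fin.Properties using (_≟_)
open import Data.Product using (Σ; _×_; ∃)
open import Relation.Binary.PropositionalEquality using (_≡_)

-- Conventions (0-indexed encoding of the paper's 1-indexed notions):
-- * S_n with n = suc m is  Permutation′ (suc m)  on  Fin (suc m);
--   position / value p : Fin (suc m) stands for the paper's p+1.
-- * A letter j : Fin m stands for the simple reflection σ_{j+1},
--   which exchanges (0-indexed) j and j+1, i.e. the paper's j+1 and j+2.
--   Hence k : Fin m ranges over the paper's [1, n-1] (paper's k = toℕ k + 1).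

Word : ℕ → Set
Word m = List (Fin m)

σ : ∀ {m} → Fin m → Fin (suc m) → Fin (suc m)
σ j = transpose (inject₁ j) (fsuc j) ⟨$⟩ʳ_

eval : ∀ {m} → Word m → Fin (suc m) → Fin (suc m)
eval []       i = i
eval (a ∷ as) i = σ a (eval as i)

Expresses : ∀ {m} → Word m → Permutation′ (suc m) → Set
Expresses ws w = ∀ i → eval ws i ≡ w ⟨$⟩ʳ i

Reduced : ∀ {m} → Word m → Permutation′ (suc m) → Set
Reduced ws w = Expresses ws w × (∀ vs → Expresses vs w → length ws ≤ length vs)

count : ∀ {m} → Fin m → Word m → ℕ
count k ws = length (filter (_≟ k) ws)

MaxIs : ∀ {m} → Fin m → Permutation′ (suc m) → ℕ → Set
MaxIs k w c =
  (Σ (Word _) λ ws → Reduced ws w × count k ws ≡ c)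
  × (∀ ws → Reduced ws w → count k ws ≤ c)

Occ3412 : ∀ {m} → Permutation′ (suc m) → (p1 p2 p3 p4 : Fin (suc m)) → Set
Occ3412 w p1 p2 p3 p4 =
  toℕ p1 < toℕ p2 × toℕ p2 < toℕ p3 × toℕ p3 < toℕ p4 ×
  toℕ (w ⟨$⟩ʳ p3) < toℕ (w ⟨$⟩ʳ p4) ×
  toℕ (w ⟨$⟩ʳ p4) < toℕ (w ⟨$⟩ʳ p1) ×
  toℕ (w ⟨$⟩ʳ p1) < toℕ (w ⟨$⟩ʳ p2)

Occ321 : ∀ {m} → Permutation′ (suc m) → (p1 p2 p3 : Fin (suc m)) → Set
Occ321 w p1 p2 p3 =
  toℕ p1 < toℕ p2 × toℕ p2 < toℕ p3 ×
  toℕ (w ⟨$⟩ʳ p1) > toℕ (w ⟨$⟩ʳ p2) ×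
  toℕ (w ⟨$⟩ʳ p2) > toℕ (w ⟨$⟩ʳ p3)
  where open Data.Nat using (_>_)

-- straddling (after the index shift, i ≤ k < i' is unchanged)
Straddles : ∀ {m} → Fin m → ℕ → ℕ → Set
Straddles k a b = a ≤ toℕ k × toℕ k < b

-- 3412 at p1<p2<p3<p4 straddles k in position: i2 ≤ k < i3
-- in value: values j1<j2<j3<j4 are w p3, w p4, w p1, w p2, so j2 ≤ k < j3
Has3412StraddlePos : ∀ {m} → Permutation′ (suc m) → Fin m → Set
Has3412StraddlePos w k = ∃ λ p1 → ∃ λ p2 → ∃ λ p3 → ∃ λ p4 →
  Occ3412 w p1 p2 p3 p4 × Straddles k (toℕ p2) (toℕ p3)

Has3412StraddleVal : ∀ {m} → Permutation′ (suc m) → Fin m → Set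
Has3412StraddleVal w k = ∃ λ p1 → ∃ λ p2 → ∃ λ p3 → ∃ λ p4 →
  Occ3412 w p1 p2 p3 p4 × Straddles k (toℕ (w ⟨$⟩ʳ p4)) (toℕ (w ⟨$⟩ʳ p1))

-- 321 at p1<p2<p3 (values j1<j2<j3 = w p3, w p2, w p1) straddling k
-- both in position (i1 ≤ k < i3) and in value (j1 ≤ k < j3)
Has321StraddleBoth : ∀ {m} → Permutation′ (suc m) → Fin m → Set
Has321StraddleBoth w k = ∃ λ p1 → ∃ λ p2 → ∃ λ p3 →
  Occ321 w p1 p2 p3 × Straddles k (toℕ p1) (toℕ p3)
  × Straddles k (toℕ (w ⟨$⟩ʳ p3)) (toℕ (w ⟨$⟩ʳ p1))

module Submission where

-- Take a reduced decomposition w = u σ_k v with exactly one σ_k.  Letters other than σ_k map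
-- the block [0, K] onto itself, so a position i ≤ K with w(i) > K must satisfy v(i) = K, and a
-- position i > K with w(i) ≤ K must satisfy v(i) = K+1: each kind of boundary crossing happens
-- at most once.  Every 3412 pattern straddling k contains two crossings of one kind.
--
-- For a straddling 321 we exhibit a reduced decomposition with two letters σ_k.  Reduced words
-- are produced by sorting the one-line notation with descent swaps: a swap of positions i, i+1
-- is right multiplication by σ_i and removes exactly one inversion, while any expression of w
-- has at least inv(w) letters; so every sorting path spells a reduced word, and its letters σ_k
-- are its swaps at position K.  Around the 321 an explicit path swaps twice at position K.

open import Defs
open import Data.Nat using (ℕ; zero; suc; _+_; _≤_; _<_; z≤n; s≤s; z<s; _≟_; _<?_)
open import Data.Nat.Induction using (<-wellFounded)
open import Induction.WellFounded using (Acc; acc)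
open import Data.Nat.Properties
open import Data.Nat.Tactic.RingSolver using (solve-∀)
open import Data.Fin as Fin using (Fin; toℕ; inject₁) renaming (zero to fzero; suc to fsuc)
import Data.Fin.Properties as Finₚ
open import Data.Fin.Permutation using (Permutation′; _⟨$⟩ʳ_; _⟨$⟩ˡ_; inverseˡ; lift₀-transpose)
open import Data.List using (List; []; _∷_; _++_; [_]; length; filter; map; reverse; applyUpTo)
open import Data.List.Properties
open import Data.List.Relation.Unary.All as All using (All; []; _∷_)
import Data.List.Relation.Unary.All.Properties as All
open import Data.List.Relation.Unary.All.Properties using (¬Any⇒All¬; applyUpTo⁺₁)
open import Data.List.Relation.Unary.Any.Properties using (applyUpTo⁺)
open import Data.List.Relation.Unary.Linked.Properties using (Linked⇒All)
open import Data.List.Relation.Unary.Any using (Any; here; there; any?)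
open import Data.List.Relation.Unary.Linked using (Linked; []; [-]; _∷_)
open import Data.List.Relation.Binary.Permutation.Propositional using (_↭_; prep; swap; ↭-refl; ↭-sym)
open import Data.List.Relation.Binary.Permutation.Propositional.Properties using (↭-length; filter-↭)
open import Data.Product using (Σ; ∃; ∃₂; _×_; _,_; proj₂)
open import Data.Sum using (_⊎_; inj₁; inj₂)
open import Function using (_∘_)
open import Relation.Nullary using (¬_; yes; no; contradiction)
open import Relation.Binary using (tri<; tri≈; tri>)
open import Relation.Binary.PropositionalEquality hiding ([_])

-- Simple reflections as arithmetic on ℕ.

τ : ℕ → ℕ → ℕ
τ zero    zero          = 1
τ zero    (suc zero)    = 0
τ zero    (suc (suc x)) = suc (suc x)
τ (suc j) zero          = zero
τ (suc j) (suc x)       = suc (τ j x)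

σ-toℕ : ∀ {m} (j : Fin m) (x : Fin (suc m)) → toℕ (σ j x) ≡ τ (toℕ j) (toℕ x)
σ-toℕ fzero    fzero           = refl
σ-toℕ fzero    (fsuc fzero)    = refl
σ-toℕ fzero    (fsuc (fsuc x)) = refl
σ-toℕ (fsuc j) fzero           = refl
σ-toℕ (fsuc j) (fsuc x)        =
  trans (cong toℕ (lift₀-transpose (inject₁ j) (fsuc j) (fsuc x))) (cong suc (σ-toℕ j x))

τ-involutive : ∀ j x → τ j (τ j x) ≡ x
τ-involutive zero    zero          = refl
τ-involutive zero    (suc zero)    = refl
τ-involutive zero    (suc (suc x)) = refl
τ-involutive (suc j) zero          = refl
τ-involutive (suc j) (suc x)       = cong suc (τ-involutive j x)

τ-< : ∀ j x {n} → x < n → suc j < n → τ j x < n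
τ-< zero    zero          x<n j<n = j<n
τ-< zero    (suc zero)    x<n j<n = <-trans z<s j<n
τ-< zero    (suc (suc x)) x<n j<n = x<n
τ-< (suc j) zero          x<n j<n = x<n
τ-< (suc j) (suc x) {suc n} (s≤s x<n) (s≤s j<n) = s≤s (τ-< j x x<n j<n)

τ-preserves-≤ : ∀ j K x → j ≢ K → x ≤ K → τ j x ≤ K
τ-preserves-≤ zero    zero    zero          j≢K x≤K = contradiction refl j≢K
τ-preserves-≤ zero    (suc K) zero          j≢K x≤K = s≤s z≤n
τ-preserves-≤ zero    K       (suc zero)    j≢K x≤K = z≤n
τ-preserves-≤ zero    K       (suc (suc x)) j≢K x≤K = x≤K
τ-preserves-≤ (suc j) K       zero          j≢K x≤K = z≤n
τ-preserves-≤ (suc j) (suc K) (suc x) j≢K (s≤s x≤K) =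
  s≤s (τ-preserves-≤ j K x (j≢K ∘ cong suc) x≤K)

τ-reflects-≤ : ∀ j K x → j ≢ K → τ j x ≤ K → x ≤ K
τ-reflects-≤ j K x j≢K τx≤K =
  subst (_≤ K) (τ-involutive j x) (τ-preserves-≤ j K (τ j x) j≢K τx≤K)

τ-up-crossing : ∀ K x → x ≤ K → K < τ K x → x ≡ K
τ-up-crossing zero    zero    x≤K      K<τx       = refl
τ-up-crossing (suc K) zero    x≤K      ()
τ-up-crossing (suc K) (suc x) (s≤s x≤K) (s≤s K<τx) = cong suc (τ-up-crossing K x x≤K K<τx)

τ-down-crossing : ∀ K x → K < x → τ K x ≤ K → x ≡ suc K
τ-down-crossing zero    (suc zero)    K<x       τx≤K      = refl
τ-down-crossing zero    (suc (suc x)) K<x       ()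
τ-down-crossing (suc K) (suc x)       (s≤s K<x) (s≤s τx≤K) = cong suc (τ-down-crossing K x K<x τx≤K)

eval-++ : ∀ {m} (xs ys : Word m) i → eval (xs ++ ys) i ≡ eval xs (eval ys i)
eval-++ []       ys i = refl
eval-++ (x ∷ xs) ys i = cong (σ x) (eval-++ xs ys i)

σ-involutive : ∀ {m} (j : Fin m) x → σ j (σ j x) ≡ x
σ-involutive j x = Finₚ.toℕ-injective (begin
  toℕ (σ j (σ j x))            ≡⟨ σ-toℕ j (σ j x) ⟩
  τ (toℕ j) (toℕ (σ j x))      ≡⟨ cong (τ (toℕ j)) (σ-toℕ j x) ⟩
  τ (toℕ j) (τ (toℕ j) (toℕ x)) ≡⟨ τ-involutive (toℕ j) (toℕ x) ⟩
  toℕ x                        ∎)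
  where open ≡-Reasoning

eval-reverse-inverse : ∀ {m} (xs : Word m) i → eval (reverse xs) (eval xs i) ≡ i
eval-reverse-inverse []       i = refl
eval-reverse-inverse (x ∷ xs) i = begin
  eval (reverse (x ∷ xs)) (σ x (eval xs i)) ≡⟨ cong (λ ys → eval ys (σ x (eval xs i))) (unfold-reverse x xs) ⟩
  eval (reverse xs ++ [ x ]) (σ x (eval xs i)) ≡⟨ eval-++ (reverse xs) [ x ] _ ⟩
  eval (reverse xs) (σ x (σ x (eval xs i)))  ≡⟨ cong (eval (reverse xs)) (σ-involutive x (eval xs i)) ⟩
  eval (reverse xs) (eval xs i)              ≡⟨ eval-reverse-inverse xs i ⟩
  i                                          ∎
  where open ≡-Reasoning

eval-injective : ∀ {m} (xs : Word m) {i j} → eval xs i ≡ eval xs j → i ≡ j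
eval-injective xs {i} {j} e =
  trans (sym (eval-reverse-inverse xs i)) (trans (cong (eval (reverse xs)) e) (eval-reverse-inverse xs j))

count-++ : ∀ {m} (k : Fin m) xs ys → count k (xs ++ ys) ≡ count k xs + count k ys
count-++ k xs ys = trans (cong length (filter-++ (Fin._≟ k) xs ys)) (length-++ (filter (Fin._≟ k) xs))

count-reverse : ∀ {m} (k : Fin m) xs → count k (reverse xs) ≡ count k xs
count-reverse k []       = refl
count-reverse k (x ∷ xs) = begin
  count k (reverse (x ∷ xs))      ≡⟨ cong (count k) (unfold-reverse x xs) ⟩
  count k (reverse xs ++ [ x ])   ≡⟨ count-++ k (reverse xs) [ x ] ⟩
  count k (reverse xs) + count k [ x ] ≡⟨ cong (_+ count k [ x ]) (count-reverse k xs) ⟩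
  count k xs + count k [ x ]      ≡⟨ +-comm (count k xs) _ ⟩
  count k [ x ] + count k xs      ≡⟨ count-++ k [ x ] xs ⟨
  count k (x ∷ xs)                ∎
  where open ≡-Reasoning

split-at-unique : ∀ {m} (k : Fin m) ws → count k ws ≡ 1 →
  Σ (Word m) λ u → Σ (Word m) λ v → ws ≡ u ++ k ∷ v × All (_≢ k) u × All (_≢ k) v
split-at-unique k []       ()
split-at-unique k (x ∷ ws) c≡1 with x Fin.≟ k
... | yes refl = [] , ws , refl , [] , no-k ws (suc-injective c≡1)
  where
    no-k : ∀ ws → count k ws ≡ 0 → All (_≢ k) ws
    no-k []       _   = []
    no-k (y ∷ ws) c≡0 with y Fin.≟ k
    ... | yes _   = contradiction c≡0 λ ()
    ... | no  y≢k = y≢k ∷ no-k ws c≡0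
... | no x≢k with split-at-unique k ws c≡1
...   | u , v , refl , u-free , v-free = x ∷ u , v , refl , x≢k ∷ u-free , v-free

-- Lists of naturals: inversions and descent swaps.

below : ℕ → List ℕ → ℕ
below x r = length (filter (_<? x) r)

inv : List ℕ → ℕ
inv []      = 0
inv (x ∷ r) = below x r + inv r

swapAt : ℕ → List ℕ → List ℕ
swapAt zero    (x ∷ y ∷ r) = y ∷ x ∷ r
swapAt (suc i) (x ∷ r)     = x ∷ swapAt i r
swapAt _       l           = l

swapAt-↭ : ∀ i l → swapAt i l ↭ l
swapAt-↭ zero    []          = ↭-refl
swapAt-↭ zero    (x ∷ [])    = ↭-refl
swapAt-↭ zero    (x ∷ y ∷ r) = swap y x ↭-refl
swapAt-↭ (suc i) []          = ↭-refl
swapAt-↭ (suc i) (x ∷ r)     = prep x (swapAt-↭ i r)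

below-↭ : ∀ x {l l′} → l ↭ l′ → below x l ≡ below x l′
below-↭ x l↭l′ = ↭-length (filter-↭ (_<? x) l↭l′)

data Step : ℕ → List ℕ → List ℕ → Set where
  here  : ∀ {x y r} → y < x → Step 0 (x ∷ y ∷ r) (y ∷ x ∷ r)
  there : ∀ {i z l l′} → Step i l l′ → Step (suc i) (z ∷ l) (z ∷ l′)

step-swapAt : ∀ {i l l′} → Step i l l′ → l′ ≡ swapAt i l
step-swapAt (here _)   = refl
step-swapAt (there st) = cong (_ ∷_) (step-swapAt st)

step-bound : ∀ {i l l′} → Step i l l′ → suc i < length l
step-bound (here _)   = s≤s (s≤s z≤n)
step-bound (there st) = s≤s (step-bound st)

inv-here : ∀ {x y} r → y < x → inv (x ∷ y ∷ r) ≡ suc (inv (y ∷ x ∷ r))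
inv-here {x} {y} r y<x = begin
  below x (y ∷ r) + (below y r + inv r)  ≡⟨ cong (_+ _) (cong length (filter-accept (_<? x) y<x)) ⟩
  suc (below x r + (below y r + inv r))  ≡⟨ cong suc (+-left-comm (below x r) (below y r) (inv r)) ⟩
  suc (below y r + (below x r + inv r))  ≡⟨ cong (λ b → suc (b + _)) (cong length (filter-reject (_<? y) (<⇒≯ y<x))) ⟨
  suc (below y (x ∷ r) + (below x r + inv r)) ∎
  where
    open ≡-Reasoning
    +-left-comm : ∀ a b c → a + (b + c) ≡ b + (a + c)
    +-left-comm a b c = trans (sym (+-assoc a b c)) (trans (cong (_+ c) (+-comm a b)) (+-assoc b a c))

inv-step : ∀ {i l l′} → Step i l l′ → inv l ≡ suc (inv l′)
inv-step (here {r = r} y<x)      = inv-here r y<x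
inv-step (there {z = z} {l} {l′} st) = begin
  below z l + inv l          ≡⟨ cong₂ _+_ (below-↭ z (↭-sym (l↭l′ st))) (inv-step st) ⟩
  below z l′ + suc (inv l′)  ≡⟨ +-suc (below z l′) (inv l′) ⟩
  suc (below z l′ + inv l′)  ∎
  where
    open ≡-Reasoning
    l↭l′ : ∀ {i l l′} → Step i l l′ → l′ ↭ l
    l↭l′ {i} {l} st = subst (_↭ l) (sym (step-swapAt st)) (swapAt-↭ i l)

inv-swapAt-≤ : ∀ i l → inv (swapAt i l) ≤ suc (inv l)
inv-swapAt-≤ zero    []          = n≤1+n _
inv-swapAt-≤ zero    (x ∷ [])    = n≤1+n _
inv-swapAt-≤ zero    (x ∷ y ∷ r) with <-cmp x y
... | tri< x<y _ _ = ≤-reflexive (inv-here r x<y)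
... | tri≈ _ refl _ = n≤1+n _
... | tri> _ _ y<x = ≤-trans (n≤1+n _) (≤-trans (≤-reflexive (sym (inv-here r y<x))) (n≤1+n _))
inv-swapAt-≤ (suc i) []          = n≤1+n _
inv-swapAt-≤ (suc i) (x ∷ r)     = begin
  below x (swapAt i r) + inv (swapAt i r) ≡⟨ cong (_+ _) (below-↭ x (swapAt-↭ i r)) ⟩
  below x r + inv (swapAt i r)            ≤⟨ +-monoʳ-≤ (below x r) (inv-swapAt-≤ i r) ⟩
  below x r + suc (inv r)                 ≡⟨ +-suc (below x r) (inv r) ⟩
  suc (below x r + inv r)                 ∎
  where open ≤-Reasoning

data Steps : List ℕ → List ℕ → List ℕ → Set where
  []  : ∀ {l} → Steps l [] l
  _∷_ : ∀ {i ps l l₁ l₂} → Step i l l₁ → Steps l₁ ps l₂ → Steps l (i ∷ ps) l₂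

restart : ∀ {l l′ ps l₂} → l′ ≡ l → Steps l ps l₂ → Steps l′ ps l₂
restart refl path = path

infixr 5 _◅◅_
_◅◅_ : ∀ {ps qs l l₁ l₂} → Steps l ps l₁ → Steps l₁ qs l₂ → Steps l (ps ++ qs) l₂
[]         ◅◅ path = path
(st ∷ sts) ◅◅ path = st ∷ (sts ◅◅ path)

inv-steps : ∀ {ps l l′} → Steps l ps l′ → inv l ≡ length ps + inv l′
inv-steps []         = refl
inv-steps (st ∷ sts) = trans (inv-step st) (cong suc (inv-steps sts))

shift : ∀ pre {ps l l′} → Steps l ps l′ → Steps (pre ++ l) (map (length pre +_) ps) (pre ++ l′)
shift pre []         = []
shift pre (st ∷ sts) = shift-step pre st ∷ shift pre sts
  where
    shift-step : ∀ pre {i l l′} → Step i l l′ → Step (length pre + i) (pre ++ l) (pre ++ l′)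
    shift-step []        st = st
    shift-step (_ ∷ pre) st = there (shift-step pre st)

swap-descent : ∀ {x y} r → y < x → Steps (x ∷ y ∷ r) [ 0 ] (y ∷ x ∷ r)
swap-descent r y<x = here y<x ∷ []

bubble-right : ∀ {x} mid r → All (_< x) mid → ∃ λ ps → Steps (x ∷ mid ++ r) ps (mid ++ x ∷ r)
bubble-right []        r []          = [] , []
bubble-right (y ∷ mid) r (y<x ∷ mid<x) with bubble-right mid r mid<x
... | ps , path = 0 ∷ map suc ps , here y<x ∷ shift [ y ] path

bubble-left : ∀ {x} mid r → All (x <_) mid → ∃ λ ps → Steps (mid ++ x ∷ r) ps (x ∷ mid ++ r)
bubble-left []        r []          = [] , []
bubble-left (y ∷ mid) r (x<y ∷ x<mid) with bubble-left mid r x<mid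
... | ps , path = map suc ps ++ [ 0 ] , shift [ y ] path ◅◅ swap-descent (mid ++ r) x<y

descent-or-sorted : ∀ l → (∃₂ λ i l′ → Step i l l′) ⊎ Linked _≤_ l
descent-or-sorted []          = inj₂ []
descent-or-sorted (x ∷ [])    = inj₂ [-]
descent-or-sorted (x ∷ y ∷ r) with y <? x | descent-or-sorted (y ∷ r)
... | yes y<x | _                      = inj₁ (0 , y ∷ x ∷ r , here y<x)
... | no  y≮x | inj₁ (i , l′ , st)     = inj₁ (suc i , x ∷ l′ , there st)
... | no  y≮x | inj₂ sorted            = inj₂ (≮⇒≥ y≮x ∷ sorted)

sort : ∀ l → ∃₂ λ ps l′ → Steps l ps l′ × Linked _≤_ l′
sort l = go l (<-wellFounded (inv l))
  where
    go : ∀ l → Acc _<_ (inv l) → ∃₂ λ ps l′ → Steps l ps l′ × Linked _≤_ l′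
    go l (acc smaller) with descent-or-sorted l
    ... | inj₂ sorted = [] , l , [] , sorted
    ... | inj₁ (i , l₁ , st) with go l₁ (smaller (≤-reflexive (sym (inv-step st))))
    ...   | ps , l′ , path , sorted = i ∷ ps , l′ , st ∷ path , sorted

occurrences : ℕ → List ℕ → ℕ
occurrences K ps = length (filter (_≟ K) ps)

occurrences-++ : ∀ K ps qs → occurrences K (ps ++ qs) ≡ occurrences K ps + occurrences K qs
occurrences-++ K ps qs = trans (cong length (filter-++ (_≟ K) ps qs)) (length-++ (filter (_≟ K) ps))

hits-twice : ∀ {K i j} → i ≡ K → j ≡ K → ∀ as bs cs → 2 ≤ occurrences K (as ++ i ∷ bs ++ j ∷ cs)
hits-twice {K} refl refl as bs cs = begin
  2                                         ≤⟨ s≤s (s≤s z≤n) ⟩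
  suc (suc (occurrences K cs))              ≡⟨ cong suc (hit cs) ⟨
  suc (occurrences K (K ∷ cs))              ≤⟨ s≤s (suffix bs) ⟩
  suc (occurrences K (bs ++ K ∷ cs))        ≡⟨ hit (bs ++ K ∷ cs) ⟨
  occurrences K (K ∷ bs ++ K ∷ cs)          ≤⟨ suffix as ⟩
  occurrences K (as ++ K ∷ bs ++ K ∷ cs)    ∎
  where
    open ≤-Reasoning
    hit : ∀ ys → occurrences K (K ∷ ys) ≡ suc (occurrences K ys)
    hit ys = cong length (filter-accept (_≟ K) refl)
    suffix : ∀ xs {ys} → occurrences K ys ≤ occurrences K (xs ++ ys)
    suffix xs {ys} = ≤-trans (m≤n+m _ _) (≤-reflexive (sym (occurrences-++ K xs ys)))

-- One-line notation of maps Fin (suc m) → Fin (suc m), as lists of naturals.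

clamp : (m : ℕ) → ℕ → Fin (suc m)
clamp m       zero    = fzero
clamp zero    (suc i) = fzero
clamp (suc m) (suc i) = fsuc (clamp m i)

toℕ-clamp : ∀ m i → i ≤ m → toℕ (clamp m i) ≡ i
toℕ-clamp m       zero    _         = refl
toℕ-clamp (suc m) (suc i) (s≤s i≤m) = cong suc (toℕ-clamp m i i≤m)

clamp-toℕ : ∀ m (x : Fin (suc m)) → clamp m (toℕ x) ≡ x
clamp-toℕ m       fzero    = refl
clamp-toℕ (suc m) (fsuc x) = cong fsuc (clamp-toℕ m x)

clamp-mono : ∀ m i → toℕ (clamp m i) ≤ toℕ (clamp m (suc i))
clamp-mono zero    zero    = z≤n
clamp-mono zero    (suc i) = z≤n
clamp-mono (suc m) zero    = z≤n
clamp-mono (suc m) (suc i) = s≤s (clamp-mono m i)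

oneLine : ∀ {m} → (Fin (suc m) → Fin (suc m)) → List ℕ
oneLine {m} f = applyUpTo (λ i → toℕ (f (clamp m i))) (suc m)

applyUpTo-cong : ∀ {G H : ℕ → ℕ} n → (∀ i → i < n → G i ≡ H i) → applyUpTo G n ≡ applyUpTo H n
applyUpTo-cong zero    _   = refl
applyUpTo-cong (suc n) G≗H = cong₂ _∷_ (G≗H 0 z<s) (applyUpTo-cong n λ i i<n → G≗H (suc i) (s≤s i<n))

oneLine-cong : ∀ {m} {f g : Fin (suc m) → Fin (suc m)} → (∀ x → f x ≡ g x) → oneLine f ≡ oneLine g
oneLine-cong {m} f≗g = applyUpTo-cong (suc m) λ i _ → cong toℕ (f≗g (clamp m i))

applyUpTo-τ : ∀ (G : ℕ → ℕ) j n → suc j < n → applyUpTo (G ∘ τ j) n ≡ swapAt j (applyUpTo G n)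
applyUpTo-τ G zero    (suc (suc n)) _         = refl
applyUpTo-τ G zero    (suc zero)    (s≤s ())
applyUpTo-τ G (suc j) (suc n)       (s≤s j<n) = cong (G 0 ∷_) (applyUpTo-τ (G ∘ suc) j n j<n)

oneLine-σ : ∀ {m} (f : Fin (suc m) → Fin (suc m)) (j : Fin m) →
  oneLine (f ∘ σ j) ≡ swapAt (toℕ j) (oneLine f)
oneLine-σ {m} f j = begin
  applyUpTo (λ i → toℕ (f (σ j (clamp m i)))) (suc m)   ≡⟨ applyUpTo-cong (suc m) (λ i i<n → cong (toℕ ∘ f) (σ-clamp i (≤-pred i<n))) ⟩
  applyUpTo (G ∘ τ (toℕ j)) (suc m)                     ≡⟨ applyUpTo-τ G (toℕ j) (suc m) (s≤s (Finₚ.toℕ<n j)) ⟩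
  swapAt (toℕ j) (oneLine f)                            ∎
  where
    open ≡-Reasoning
    G : ℕ → ℕ
    G i = toℕ (f (clamp m i))
    σ-clamp : ∀ i → i ≤ m → σ j (clamp m i) ≡ clamp m (τ (toℕ j) i)
    σ-clamp i i≤m = Finₚ.toℕ-injective (begin
      toℕ (σ j (clamp m i))           ≡⟨ σ-toℕ j (clamp m i) ⟩
      τ (toℕ j) (toℕ (clamp m i))     ≡⟨ cong (τ (toℕ j)) (toℕ-clamp m i i≤m) ⟩
      τ (toℕ j) i                     ≡⟨ toℕ-clamp m _ (≤-pred (τ-< (toℕ j) i (s≤s i≤m) (s≤s (Finₚ.toℕ<n j)))) ⟨
      toℕ (clamp m (τ (toℕ j) i))     ∎)

length-oneLine : ∀ {m} (f : Fin (suc m) → Fin (suc m)) → length (oneLine f) ≡ suc m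
length-oneLine {m} f = length-applyUpTo (λ i → toℕ (f (clamp m i))) (suc m)

inv-sorted : ∀ {l} → Linked _≤_ l → inv l ≡ 0
inv-sorted []                          = refl
inv-sorted [-]                         = refl
inv-sorted {x ∷ _ ∷ _} (x≤y ∷ sorted) =
  cong₂ _+_ (cong length (filter-none (_<? x) (All.map ≤⇒≯ (Linked⇒All ≤-trans x≤y sorted))))
            (inv-sorted sorted)

oneLine-id-sorted : ∀ m → Linked _≤_ (oneLine {m} (λ x → x))
oneLine-id-sorted m = increasing (suc m) (clamp-mono m)
  where
    increasing : ∀ {G : ℕ → ℕ} n → (∀ i → G i ≤ G (suc i)) → Linked _≤_ (applyUpTo G n)
    increasing zero                _   = []
    increasing (suc zero)          _   = [-]
    increasing {G} (suc (suc n)) mono = mono 0 ∷ increasing {G ∘ suc} (suc n) (mono ∘ suc)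

sorted-injective⇒identity : ∀ {m} (g : Fin (suc m) → Fin (suc m)) → (∀ {x y} → g x ≡ g y → x ≡ y) →
  Linked _≤_ (oneLine g) → ∀ x → g x ≡ x
sorted-injective⇒identity {m} g g-inj sorted x = Finₚ.toℕ-injective (begin
  toℕ (g x)               ≡⟨ cong (toℕ ∘ g) (clamp-toℕ m x) ⟨
  G (toℕ x)               ≡⟨ G-identity (toℕ x) (Finₚ.toℕ<n x) ⟩
  toℕ x                   ∎)
  where
    open ≡-Reasoning
    n = suc m
    G : ℕ → ℕ
    G i = toℕ (g (clamp m i))

    monotone : ∀ {G : ℕ → ℕ} n → Linked _≤_ (applyUpTo G n) → ∀ i → suc i < n → G i ≤ G (suc i)
    monotone (suc zero)    _              zero    (s≤s ())
    monotone (suc (suc n)) (G₀≤G₁ ∷ _)    zero    _         = G₀≤G₁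
    monotone {G} (suc (suc n)) (_ ∷ sorted′) (suc i) (s≤s i<n) = monotone {G ∘ suc} (suc n) sorted′ i i<n

    strict : ∀ i → suc i < n → G i < G (suc i)
    strict i i+1<n = ≤∧≢⇒< (monotone {G} n sorted i i+1<n) λ Gi≡Gi+1 →
      1+n≢n (sym (begin
        i                         ≡⟨ toℕ-clamp m i (≤-pred (<-trans (n<1+n i) i+1<n)) ⟨
        toℕ (clamp m i)           ≡⟨ cong toℕ (g-inj (Finₚ.toℕ-injective Gi≡Gi+1)) ⟩
        toℕ (clamp m (suc i))     ≡⟨ toℕ-clamp m (suc i) (≤-pred i+1<n) ⟩
        suc i                     ∎))

    gap : ∀ i d → i + d < n → G i + d ≤ G (i + d)
    gap i zero    _        = ≤-reflexive (trans (+-identityʳ (G i)) (cong G (sym (+-identityʳ i))))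
    gap i (suc d) i+d+1<n  = let i+d+1<n′ = subst (_< n) (+-suc i d) i+d+1<n in
      ≤-Reasoning.begin
        G i + suc d         ≤-Reasoning.≡⟨ +-suc (G i) d ⟩
        suc (G i + d)       ≤-Reasoning.≤⟨ s≤s (gap i d (<-trans (n<1+n (i + d)) i+d+1<n′)) ⟩
        suc (G (i + d))     ≤-Reasoning.≤⟨ strict (i + d) i+d+1<n′ ⟩
        G (suc (i + d))     ≤-Reasoning.≡⟨ cong G (+-suc i d) ⟨
        G (i + suc d)       ≤-Reasoning.∎

    -- G is strictly increasing from [0, n) into [0, n), hence the identity there
    G-identity : ∀ i → i < n → G i ≡ i
    G-identity i i<n with m≤n⇒∃[o]m+o≡n i<n
    ... | d , i+1+d≡n = ≤-antisym upper lower
      where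
        lower : i ≤ G i
        lower = ≤-trans (m≤n+m i (G 0)) (gap 0 i i<n)
        upper : G i ≤ i
        upper = +-cancelʳ-≤ d (G i) i (≤-pred (≤-trans (s≤s (gap i d (≤-reflexive i+1+d≡n)))
                  (≤-trans (Finₚ.toℕ<n (g (clamp m (i + d)))) (≤-reflexive (sym i+1+d≡n)))))

count-toℕ : ∀ {m} (k : Fin m) js → count k js ≡ occurrences (toℕ k) (map toℕ js)
count-toℕ k []       = refl
count-toℕ k (j ∷ js) with j Finₚ.≟ k
... | yes refl = trans (cong suc (count-toℕ k js)) (sym (cong length (filter-accept (_≟ toℕ k) refl)))
... | no  j≢k  = trans (count-toℕ k js) (sym (cong length (filter-reject (_≟ toℕ k) (j≢k ∘ Finₚ.toℕ-injective))))

realise : ∀ {m} (f : Fin (suc m) → Fin (suc m)) {ps l} → Steps (oneLine f) ps l →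
  Σ (Word m) λ js → map toℕ js ≡ ps × oneLine (f ∘ eval js) ≡ l
realise f []                   = [] , refl , refl
realise {m} f (_∷_ {i} {ps} {l₁ = l₁} {l₂} st sts)
  with realise (f ∘ σ j) (subst (λ l → Steps l ps l₂) after-swap sts)
  where
    i<m : i < m
    i<m = ≤-pred (subst (suc i <_) (length-oneLine f) (step-bound st))
    j : Fin m
    j = Fin.fromℕ< i<m
    after-swap : l₁ ≡ oneLine (f ∘ σ j)
    after-swap = trans (step-swapAt st)
      (sym (trans (oneLine-σ f j) (cong (λ t → swapAt t (oneLine f)) (Finₚ.toℕ-fromℕ< i<m))))
... | js , js≡ps , final = _ ∷ js , cong₂ _∷_ (Finₚ.toℕ-fromℕ< _) js≡ps , final

-- Every expression of f as a product of simple reflections has at least inv (oneLine f) letters: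
-- right multiplication by one simple reflection changes the inversion number by at most one.
inv-lower-bound : ∀ {m} (xs : Word m) (f : Fin (suc m) → Fin (suc m)) →
  (∀ x → eval xs x ≡ f x) → inv (oneLine f) ≤ length xs
inv-lower-bound {m} xs f xs-expresses-f = begin
  inv (oneLine f)                            ≡⟨ cong inv (oneLine-cong reverse-reverse) ⟨
  inv (oneLine (eval (reverse (reverse xs)))) ≤⟨ bound (reverse xs) ⟩
  length (reverse xs)                        ≡⟨ length-reverse xs ⟩
  length xs                                  ∎
  where
    open ≤-Reasoning
    reverse-reverse : ∀ x → eval (reverse (reverse xs)) x ≡ f x
    reverse-reverse x = trans (cong (λ ys → eval ys x) (reverse-involutive xs)) (xs-expresses-f x)
    bound : ∀ ys → inv (oneLine (eval (reverse ys))) ≤ length ys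
    bound []       = ≤-reflexive (inv-sorted (oneLine-id-sorted m))
    bound (y ∷ ys) = begin
      inv (oneLine (eval (reverse (y ∷ ys))))       ≡⟨ cong inv (oneLine-cong λ x → trans
                                                         (cong (λ zs → eval zs x) (unfold-reverse y ys))
                                                         (eval-++ (reverse ys) [ y ] x)) ⟩
      inv (oneLine (eval (reverse ys) ∘ σ y))       ≡⟨ cong inv (oneLine-σ (eval (reverse ys)) y) ⟩
      inv (swapAt (toℕ y) (oneLine (eval (reverse ys)))) ≤⟨ inv-swapAt-≤ (toℕ y) _ ⟩
      suc (inv (oneLine (eval (reverse ys))))       ≤⟨ s≤s (bound ys) ⟩
      suc (length ys)                               ∎

-- Any path of descent swaps from the one-line notation of w extends, by bubble sort, to a
-- reduced decomposition of w using σ_k at least as often as the path swaps at position k.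
reduced-word-through : ∀ {m} (w : Permutation′ (suc m)) (k : Fin m) {ps l} →
  Steps (oneLine (w ⟨$⟩ʳ_)) ps l → Σ (Word m) λ ws → Reduced ws w × occurrences (toℕ k) ps ≤ count k ws
reduced-word-through {m} w k {ps} {l} path with sort l
... | qs , l′ , sorting , sorted with realise (w ⟨$⟩ʳ_) (path ◅◅ sorting)
...   | js , js≡ , final = reverse js , (expresses , minimal) , more-k
  where
    f : Fin (suc m) → Fin (suc m)
    f = w ⟨$⟩ʳ_
    w-injective : ∀ {x y} → f x ≡ f y → x ≡ y
    w-injective {x} {y} e = trans (sym (inverseˡ w)) (trans (cong (w ⟨$⟩ˡ_) e) (inverseˡ w))
    identity : ∀ x → f (eval js x) ≡ x
    identity = sorted-injective⇒identity (f ∘ eval js) (eval-injective js ∘ w-injective)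
                 (subst (Linked _≤_) (sym final) sorted)
    expresses : Expresses (reverse js) w
    expresses x = begin
      eval (reverse js) x                      ≡⟨ identity (eval (reverse js) x) ⟨
      f (eval js (eval (reverse js) x))        ≡⟨ cong f (trans (cong (λ ys → eval ys (eval (reverse js) x))
                                                    (sym (reverse-involutive js))) (eval-reverse-inverse (reverse js) x)) ⟩
      f x                                      ∎
      where open ≡-Reasoning
    length-js : length js ≡ length (ps ++ qs)
    length-js = trans (sym (length-map toℕ js)) (cong length js≡)
    minimal : ∀ vs → Expresses vs w → length (reverse js) ≤ length vs
    minimal vs vs-expresses = begin
      length (reverse js)                   ≡⟨ trans (length-reverse js) length-js ⟩
      length (ps ++ qs)                     ≤⟨ m≤m+n _ _ ⟩
      length (ps ++ qs) + inv l′            ≡⟨ inv-steps (path ◅◅ sorting) ⟨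
      inv (oneLine f)                       ≤⟨ inv-lower-bound vs f vs-expresses ⟩
      length vs                             ∎
      where open ≤-Reasoning
    more-k : occurrences (toℕ k) ps ≤ count k (reverse js)
    more-k = begin
      occurrences (toℕ k) ps                               ≤⟨ m≤m+n _ _ ⟩
      occurrences (toℕ k) ps + occurrences (toℕ k) qs      ≡⟨ occurrences-++ (toℕ k) ps qs ⟨
      occurrences (toℕ k) (ps ++ qs)                       ≡⟨ cong (occurrences (toℕ k)) js≡ ⟨
      occurrences (toℕ k) (map toℕ js)                     ≡⟨ count-toℕ k js ⟨
      count k js                                           ≡⟨ count-reverse k js ⟨
      count k (reverse js)                                 ∎
      where open ≤-Reasoning

-- Two swaps at a prescribed position.

split-last-above : ∀ c X → Any (c <_) X →
  ∃₂ λ X₁ b → ∃ λ X₂ → X ≡ X₁ ++ b ∷ X₂ × c < b × All (_≤ c) X₂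
split-last-above c (x ∷ X) x∨X-above with any? (c <?_) X
split-last-above c (x ∷ X) _            | yes X-above with split-last-above c X X-above
... | X₁ , b , X₂ , refl , c<b , X₂≤c = x ∷ X₁ , b , X₂ , refl , c<b , X₂≤c
split-last-above c (x ∷ X) (here c<x)   | no none =
  [] , x , X , refl , c<x , All.map ≮⇒≥ (¬Any⇒All¬ X none)
split-last-above c (x ∷ X) (there X-above) | no none = contradiction X-above none

split-first-below : ∀ a Y → Any (_< a) Y →
  ∃₂ λ Y₁ b → ∃ λ Y₂ → Y ≡ Y₁ ++ b ∷ Y₂ × b < a × All (a ≤_) Y₁
split-first-below a (y ∷ Y) y∨Y-below with y <? a
... | yes y<a = [] , y , Y , refl , y<a , []
split-first-below a (y ∷ Y) (here y<a)    | no y≮a = contradiction y<a y≮a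
split-first-below a (y ∷ Y) (there Y-below) | no y≮a with split-first-below a Y Y-below
... | Y₁ , b , Y₂ , refl , b<a , a≤Y₁ = y ∷ Y₁ , b , Y₂ , refl , b<a , ≮⇒≥ y≮a ∷ a≤Y₁

TwiceAt : ℕ → List ℕ → Set
TwiceAt K l = ∃₂ λ ps l′ → Steps l ps l′ × 2 ≤ occurrences K ps

twice-via : ∀ {K i j l l₁ l₂ l₃ l₄ ps qs} → Steps l ps l₁ → Steps l₁ [ i ] l₂ → Steps l₂ qs l₃ →
  Steps l₃ [ j ] l₄ → i ≡ K → j ≡ K → TwiceAt K l
twice-via {ps = ps} {qs} before first between second i≡K j≡K =
  _ , _ , before ◅◅ first ◅◅ between ◅◅ second , hits-twice i≡K j≡K ps qs []

-- If some b with a > b > c lies in X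
-- or in Y, there is a path of descent swaps swapping twice at position K.

-- b in X, chosen last in X above c, so X = X₁ ++ b ∷ X₂ with X₂ ≤ c (writing R = Y ++ Y′):
--   pre a X₁ b X₂ Y c Y′  →  pre a X₁ X₂ b Y c Y′  →  pre a X₁ X₂ b c R  →(at K)  pre a X₁ X₂ c b R
--   →  pre X₁ X₂ a c b R  →  pre X₁ X₂ c a b R  →(at K)  pre X₁ X₂ c b a R
twice-at-boundary-left : ∀ {K a c} pre X Y Y′ → length pre + length X ≡ K → K < a → c ≤ K →
  All (_≤ K) X → All (K <_) Y → Any (c <_) X → TwiceAt K (pre ++ a ∷ X ++ Y ++ c ∷ Y′)
twice-at-boundary-left {K} {a} {c} pre X Y Y′ len K<a c≤K X≤K K<Y X-above
  with split-last-above c X X-above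
... | X₁ , b , X₂ , refl , c<b , X₂≤c =
  twice-via (restart start (shift pre (shift (a ∷ X₁) (proj₂ b-past-X₂))
                            ◅◅ shift pre (shift (a ∷ X₁) (shift X₂ (shift [ b ] (proj₂ c-past-Y))))))
            (shift pre (shift (a ∷ X₁) (shift X₂ (swap-descent R c<b))))
            (shift pre (proj₂ a-past-X₁)
               ◅◅ shift pre (shift X₁ (proj₂ a-past-X₂))
               ◅◅ shift pre (shift X₁ (shift X₂ (swap-descent (b ∷ R) (≤-<-trans c≤K K<a)))))
            (shift pre (shift X₁ (shift X₂ (shift [ c ] (swap-descent R b<a)))))
            first-at-K second-at-K
  where
    R : List ℕ
    R = Y ++ Y′
    b<a : b < a
    b<a = ≤-<-trans (All.head (All.++⁻ʳ X₁ X≤K)) K<a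
    X<a : ∀ Z → All (_≤ K) Z → All (_< a) Z
    X<a Z Z≤K = All.map (λ z≤K → ≤-<-trans z≤K K<a) Z≤K
    b-past-X₂ : ∃ λ ps → Steps (b ∷ X₂ ++ Y ++ c ∷ Y′) ps (X₂ ++ b ∷ Y ++ c ∷ Y′)
    b-past-X₂ = bubble-right X₂ (Y ++ c ∷ Y′) (All.map (λ z≤c → ≤-<-trans z≤c c<b) X₂≤c)
    c-past-Y : ∃ λ ps → Steps (Y ++ c ∷ Y′) ps (c ∷ Y ++ Y′)
    c-past-Y = bubble-left Y Y′ (All.map (≤-<-trans c≤K) K<Y)
    a-past-X₁ : ∃ λ ps → Steps (a ∷ X₁ ++ X₂ ++ c ∷ b ∷ R) ps (X₁ ++ a ∷ X₂ ++ c ∷ b ∷ R)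
    a-past-X₁ = bubble-right X₁ (X₂ ++ c ∷ b ∷ R) (X<a X₁ (All.++⁻ˡ X₁ X≤K))
    a-past-X₂ : ∃ λ ps → Steps (a ∷ X₂ ++ c ∷ b ∷ R) ps (X₂ ++ a ∷ c ∷ b ∷ R)
    a-past-X₂ = bubble-right X₂ (c ∷ b ∷ R) (X<a X₂ (All.tail (All.++⁻ʳ X₁ X≤K)))
    start : pre ++ a ∷ (X₁ ++ b ∷ X₂) ++ Y ++ c ∷ Y′ ≡ pre ++ a ∷ X₁ ++ b ∷ X₂ ++ Y ++ c ∷ Y′
    start = cong (λ Z → pre ++ a ∷ Z) (++-assoc X₁ (b ∷ X₂) (Y ++ c ∷ Y′))
    length-X : length (X₁ ++ b ∷ X₂) ≡ suc (length X₁ + length X₂)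
    length-X = trans (length-++ X₁) (+-suc (length X₁) (length X₂))
    first-at-K : length pre + suc (length X₁ + (length X₂ + 0)) ≡ K
    first-at-K = trans (cong (λ t → length pre + suc (length X₁ + t)) (+-identityʳ (length X₂)))
                       (trans (cong (length pre +_) (sym length-X)) len)
    second-at-K : length pre + (length X₁ + (length X₂ + 1)) ≡ K
    second-at-K = trans (cong (λ t → length pre + (length X₁ + t)) (+-comm (length X₂) 1))
                        (trans (cong (length pre +_) (trans (+-suc (length X₁) (length X₂)) (sym length-X))) len)

-- b in Y, chosen first in Y below a, so Y = Y₁ ++ b ∷ Y₂ with Y₁ ≥ a:
--   pre a X Y₁ b Y₂ c Y′  →  pre X a Y₁ b Y₂ c Y′  →  pre X a b Y₁ Y₂ c Y′  →(at K)  pre X b a Y₁ Y₂ c Y′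
--   →  pre X b a Y₁ c Y₂ Y′  →  pre X b a c Y₁ Y₂ Y′  →  pre X b c a Y₁ Y₂ Y′  →(at K)  pre X c b a Y₁ Y₂ Y′
twice-at-boundary-right : ∀ {K a c} pre X Y Y′ → length pre + length X ≡ K → K < a → c ≤ K →
  All (_≤ K) X → All (K <_) Y → Any (_< a) Y → TwiceAt K (pre ++ a ∷ X ++ Y ++ c ∷ Y′)
twice-at-boundary-right {K} {a} {c} pre X Y Y′ len K<a c≤K X≤K K<Y Y-below
  with split-first-below a Y Y-below
... | Y₁ , b , Y₂ , refl , b<a , a≤Y₁ =
  twice-via (restart start (shift pre (proj₂ a-past-X) ◅◅ shift pre (shift X (shift [ a ] (proj₂ b-past-Y₁)))))
            (shift pre (shift X (swap-descent (Y₁ ++ Y₂ ++ c ∷ Y′) b<a)))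
            (shift pre (shift X (shift [ b ] (shift [ a ] (shift Y₁ (proj₂ c-past-Y₂)))))
               ◅◅ shift pre (shift X (shift [ b ] (shift [ a ] (proj₂ c-past-Y₁))))
               ◅◅ shift pre (shift X (shift [ b ] (swap-descent (Y₁ ++ Y₂ ++ Y′) (≤-<-trans c≤K K<a)))))
            (shift pre (shift X (swap-descent (a ∷ Y₁ ++ Y₂ ++ Y′) (≤-<-trans c≤K K<b))))
            at-K at-K
  where
    K<b : K < b
    K<b = All.head (All.++⁻ʳ Y₁ K<Y)
    c<Z : ∀ Z → All (K <_) Z → All (c <_) Z
    c<Z Z K<Z = All.map (≤-<-trans c≤K) K<Z
    a-past-X : ∃ λ ps → Steps (a ∷ X ++ Y₁ ++ b ∷ Y₂ ++ c ∷ Y′) ps (X ++ a ∷ Y₁ ++ b ∷ Y₂ ++ c ∷ Y′)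
    a-past-X = bubble-right X (Y₁ ++ b ∷ Y₂ ++ c ∷ Y′) (All.map (λ x≤K → ≤-<-trans x≤K K<a) X≤K)
    b-past-Y₁ : ∃ λ ps → Steps (Y₁ ++ b ∷ Y₂ ++ c ∷ Y′) ps (b ∷ Y₁ ++ Y₂ ++ c ∷ Y′)
    b-past-Y₁ = bubble-left Y₁ (Y₂ ++ c ∷ Y′) (All.map (<-≤-trans b<a) a≤Y₁)
    c-past-Y₂ : ∃ λ ps → Steps (Y₂ ++ c ∷ Y′) ps (c ∷ Y₂ ++ Y′)
    c-past-Y₂ = bubble-left Y₂ Y′ (c<Z Y₂ (All.tail (All.++⁻ʳ Y₁ K<Y)))
    c-past-Y₁ : ∃ λ ps → Steps (Y₁ ++ c ∷ Y₂ ++ Y′) ps (c ∷ Y₁ ++ Y₂ ++ Y′)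
    c-past-Y₁ = bubble-left Y₁ (Y₂ ++ Y′) (c<Z Y₁ (All.++⁻ˡ Y₁ K<Y))
    start : pre ++ a ∷ X ++ (Y₁ ++ b ∷ Y₂) ++ c ∷ Y′ ≡ pre ++ a ∷ X ++ Y₁ ++ b ∷ Y₂ ++ c ∷ Y′
    start = cong (λ Z → pre ++ a ∷ X ++ Z) (++-assoc Y₁ (b ∷ Y₂) (c ∷ Y′))
    at-K : length pre + (length X + 0) ≡ K
    at-K = trans (cong (length pre +_) (+-identityʳ (length X))) len

-- Cutting the values of G on [0, n) at positions p ≤ K < q < n into
-- pre ++ G p ∷ X ++ Y ++ G q ∷ rest,  where X holds the positions (p, K] and Y those in (K, q).
record Cut (G : ℕ → ℕ) (n p K q : ℕ) : Set₁ where
  field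
    pre X Y rest : List ℕ
    shape   : applyUpTo G n ≡ pre ++ G p ∷ X ++ Y ++ G q ∷ rest
    lengths : length pre + length X ≡ K
    X-all   : ∀ {P : ℕ → Set} → (∀ {i} → p < i → i ≤ K → P (G i)) → All P X
    X-any   : ∀ {P : ℕ → Set} {i} → p < i → i ≤ K → P (G i) → Any P X
    Y-all   : ∀ {P : ℕ → Set} → (∀ {i} → K < i → i < q → P (G i)) → All P Y
    Y-any   : ∀ {P : ℕ → Set} {i} → K < i → i < q → P (G i) → Any P Y

applyUpTo-++ : ∀ (G : ℕ → ℕ) d e → applyUpTo G (d + e) ≡ applyUpTo G d ++ applyUpTo (λ t → G (d + t)) e
applyUpTo-++ G zero    e = refl
applyUpTo-++ G (suc d) e = cong (G 0 ∷_) (applyUpTo-++ (G ∘ suc) d e)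

applyUpTo-split : ∀ (G : ℕ → ℕ) i d → applyUpTo G (suc i + d) ≡ applyUpTo G i ++ G i ∷ applyUpTo (λ t → G (suc i + t)) d
applyUpTo-split G zero    d = refl
applyUpTo-split G (suc i) d = cong (G 0 ∷_) (applyUpTo-split (G ∘ suc) i d)

cut : ∀ (G : ℕ → ℕ) {n p K q} → p ≤ K → K < q → q < n → Cut G n p K q
cut G {p = p} p≤K K<q q<n with m≤n⇒∃[o]m+o≡n p≤K | m≤n⇒∃[o]m+o≡n K<q | m≤n⇒∃[o]m+o≡n q<n
... | dX , refl | dY , refl | dR , refl = record
  { pre = applyUpTo G p ; X = applyUpTo HX dX ; Y = applyUpTo HY dY ; rest = applyUpTo (λ t → HY (suc dY + t)) dR
  ; shape   = shape
  ; lengths = cong₂ _+_ (length-applyUpTo G p) (length-applyUpTo HX dX)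
  ; X-all   = λ h → applyUpTo⁺₁ HX dX λ t<dX → h (s≤s (m≤m+n p _)) (+-monoʳ-< p t<dX)
  ; X-any   = X-any
  ; Y-all   = λ h → applyUpTo⁺₁ HY dY λ {t} t<dY →
                h (s≤s (+-monoʳ-≤ p (m≤m+n dX t)))
                  (s≤s (subst (_< p + dX + dY) (+-assoc p dX t) (+-monoʳ-< (p + dX) t<dY)))
  ; Y-any   = Y-any
  }
  where
    HX HY : ℕ → ℕ
    HX t = G (suc p + t)
    HY t = HX (dX + t)
    shape : applyUpTo G (suc (suc (p + dX) + dY) + dR)
          ≡ applyUpTo G p ++ G p ∷ applyUpTo HX dX ++ applyUpTo HY dY ++ G (suc (p + dX) + dY) ∷ applyUpTo (λ t → HY (suc dY + t)) dR
    shape = begin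
      applyUpTo G (suc (suc (p + dX) + dY) + dR)   ≡⟨ cong (applyUpTo G) (pieces p dX dY dR) ⟩
      applyUpTo G (suc p + (dX + (suc dY + dR)))   ≡⟨ applyUpTo-split G p _ ⟩
      applyUpTo G p ++ G p ∷ applyUpTo HX (dX + (suc dY + dR))
        ≡⟨ cong (λ Z → applyUpTo G p ++ G p ∷ Z) (applyUpTo-++ HX dX _) ⟩
      applyUpTo G p ++ G p ∷ applyUpTo HX dX ++ applyUpTo HY (suc dY + dR)
        ≡⟨ cong (λ Z → applyUpTo G p ++ G p ∷ applyUpTo HX dX ++ Z) (applyUpTo-split HY dY dR) ⟩
      applyUpTo G p ++ G p ∷ applyUpTo HX dX ++ applyUpTo HY dY ++ HY dY ∷ applyUpTo (λ t → HY (suc dY + t)) dR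
        ≡⟨ cong (λ v → applyUpTo G p ++ G p ∷ applyUpTo HX dX ++ applyUpTo HY dY ++ v ∷ applyUpTo (λ t → HY (suc dY + t)) dR) (cong (G ∘ suc) (+-assoc p dX dY)) ⟨
      _ ∎
      where
        open ≡-Reasoning
        pieces : ∀ p x y r → suc (suc (p + x) + y) + r ≡ suc p + (x + (suc y + r))
        pieces = solve-∀
    X-any : ∀ {P : ℕ → Set} {i} → p < i → i ≤ p + dX → P (G i) → Any P (applyUpTo HX dX)
    X-any p<i i≤K Pi with m≤n⇒∃[o]m+o≡n p<i
    ... | t , refl = applyUpTo⁺ HX Pi (+-cancelˡ-≤ p (suc t) dX (subst (_≤ p + dX) (sym (+-suc p t)) i≤K))
    Y-any : ∀ {P : ℕ → Set} {i} → p + dX < i → i < suc (p + dX) + dY → P (G i) → Any P (applyUpTo HY dY)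
    Y-any {P} K<i i<q Pi with m≤n⇒∃[o]m+o≡n K<i
    ... | t , refl = applyUpTo⁺ HY (subst P (cong (G ∘ suc) (+-assoc p dX t)) Pi)
                                   (+-cancelˡ-< (p + dX) t dY (≤-pred i<q))

twice-reduced : ∀ {m} (w : Permutation′ (suc m)) (k : Fin m) → TwiceAt (toℕ k) (oneLine (w ⟨$⟩ʳ_)) →
  Σ (Word m) λ ws → Reduced ws w × 2 ≤ count k ws
twice-reduced w k (_ , _ , path , twice) with reduced-word-through w k path
... | ws , reduced , more = ws , reduced , ≤-trans twice more

-- Crossings of the boundary between K and K+1.

eval-preserves-block : ∀ {m} (k : Fin m) ws → All (_≢ k) ws →
  ∀ x → toℕ x ≤ toℕ k → toℕ (eval ws x) ≤ toℕ k
eval-preserves-block k []       _              x x≤K = x≤K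
eval-preserves-block k (j ∷ ws) (j≢k ∷ ws-free) x x≤K =
  subst (_≤ toℕ k) (sym (σ-toℕ j (eval ws x)))
    (τ-preserves-≤ (toℕ j) (toℕ k) _ (j≢k ∘ Finₚ.toℕ-injective) (eval-preserves-block k ws ws-free x x≤K))

eval-reflects-block : ∀ {m} (k : Fin m) ws → All (_≢ k) ws →
  ∀ x → toℕ (eval ws x) ≤ toℕ k → toℕ x ≤ toℕ k
eval-reflects-block k []       _              x x≤K = x≤K
eval-reflects-block k (j ∷ ws) (j≢k ∷ ws-free) x wsx≤K =
  eval-reflects-block k ws ws-free x
    (τ-reflects-≤ (toℕ j) (toℕ k) _ (j≢k ∘ Finₚ.toℕ-injective) (subst (_≤ toℕ k) (σ-toℕ j (eval ws x)) wsx≤K))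

-- Fix an expression w = u σ_k v with u and v free of σ_k.  Then a position of [0, K] whose
-- value lies above K must be sent to K by v, and a position above K whose value lies in
-- [0, K] must be sent to K+1 by v; so each kind of crossing happens at most once.
module Crossings {m} (w : Permutation′ (suc m)) (k : Fin m) (u v : Word m)
  (expresses : Expresses (u ++ k ∷ v) w) (u-free : All (_≢ k) u) (v-free : All (_≢ k) v) where

  K : ℕ
  K = toℕ k

  UpCrossing DownCrossing : Fin (suc m) → Set
  UpCrossing   i = toℕ i ≤ K × K < toℕ (w ⟨$⟩ʳ i)
  DownCrossing i = K < toℕ i × toℕ (w ⟨$⟩ʳ i) ≤ K

  factorisation : ∀ i → w ⟨$⟩ʳ i ≡ eval u (σ k (eval v i))
  factorisation i = trans (sym (expresses i)) (eval-++ u (k ∷ v) i)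

  up-crossing-at-K : ∀ {i} → UpCrossing i → toℕ (eval v i) ≡ K
  up-crossing-at-K {i} (i≤K , K<wi) with toℕ (σ k (eval v i)) ≤? K
  ... | yes σvi≤K = contradiction (subst (λ x → toℕ x ≤ K) (sym (factorisation i))
                      (eval-preserves-block k u u-free _ σvi≤K)) (<⇒≱ K<wi)
  ... | no  σvi≰K = τ-up-crossing K _ (eval-preserves-block k v v-free i i≤K)
                      (subst (K <_) (σ-toℕ k (eval v i)) (≰⇒> σvi≰K))

  down-crossing-at-K+1 : ∀ {i} → DownCrossing i → toℕ (eval v i) ≡ suc K
  down-crossing-at-K+1 {i} (K<i , wi≤K) with toℕ (eval v i) ≤? K
  ... | yes vi≤K = contradiction (eval-reflects-block k v v-free i vi≤K) (<⇒≱ K<i)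
  ... | no  vi≰K = τ-down-crossing K _ (≰⇒> vi≰K) (subst (_≤ K) (σ-toℕ k (eval v i))
                     (eval-reflects-block k u u-free _ (subst (λ x → toℕ x ≤ K) (factorisation i) wi≤K)))

  -- positions with the same image under v coincide, since w is injective
  same-under-v : ∀ {i j} → toℕ (eval v i) ≡ toℕ (eval v j) → toℕ i ≡ toℕ j
  same-under-v {i} {j} e = cong toℕ (begin
    i                                  ≡⟨ inverseˡ w ⟨
    w ⟨$⟩ˡ (w ⟨$⟩ʳ i)                  ≡⟨ cong (w ⟨$⟩ˡ_) (trans (factorisation i) (trans
                                            (cong (eval u ∘ σ k) (Finₚ.toℕ-injective e)) (sym (factorisation j)))) ⟩
    w ⟨$⟩ˡ (w ⟨$⟩ʳ j)                  ≡⟨ inverseˡ w ⟩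
    j                                  ∎)
    where open ≡-Reasoning

  up-crossing-unique : ∀ {i j} → UpCrossing i → UpCrossing j → toℕ i ≡ toℕ j
  up-crossing-unique i↑ j↑ = same-under-v (trans (up-crossing-at-K i↑) (sym (up-crossing-at-K j↑)))

  down-crossing-unique : ∀ {i j} → DownCrossing i → DownCrossing j → toℕ i ≡ toℕ j
  down-crossing-unique i↓ j↓ = same-under-v (trans (down-crossing-at-K+1 i↓) (sym (down-crossing-at-K+1 j↓)))

  -- A 3412 straddling k in position or in value needs two crossings of the same kind.
  no-3412-position : ¬ Has3412StraddlePos w k
  no-3412-position (p₁ , p₂ , p₃ , p₄ , (p₁<p₂ , _ , p₃<p₄ , w₃<w₄ , w₄<w₁ , w₁<w₂) , (p₂≤K , K<p₃))
    with toℕ (w ⟨$⟩ʳ p₄) ≤? K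
  ... | yes w₄≤K = <-irrefl (down-crossing-unique (K<p₃ , ≤-trans (<⇒≤ w₃<w₄) w₄≤K)
                                                  (<-trans K<p₃ p₃<p₄ , w₄≤K)) p₃<p₄
  ... | no  w₄≰K = <-irrefl (up-crossing-unique (≤-trans (<⇒≤ p₁<p₂) p₂≤K , <-trans (≰⇒> w₄≰K) w₄<w₁)
                                                (p₂≤K , <-trans (<-trans (≰⇒> w₄≰K) w₄<w₁) w₁<w₂)) p₁<p₂

  no-3412-value : ¬ Has3412StraddleVal w k
  no-3412-value (p₁ , p₂ , p₃ , p₄ , (p₁<p₂ , p₂<p₃ , p₃<p₄ , w₃<w₄ , _ , w₁<w₂) , (w₄≤K , K<w₁))
    with toℕ p₂ ≤? K
  ... | yes p₂≤K = <-irrefl (up-crossing-unique (≤-trans (<⇒≤ p₁<p₂) p₂≤K , K<w₁)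
                                                (p₂≤K , <-trans K<w₁ w₁<w₂)) p₁<p₂
  ... | no  p₂≰K = <-irrefl (down-crossing-unique (<-trans (≰⇒> p₂≰K) p₂<p₃ , ≤-trans (<⇒≤ w₃<w₄) w₄≤K)
                                                  (<-trans (<-trans (≰⇒> p₂≰K) p₂<p₃) p₃<p₄ , w₄≤K)) p₃<p₄

  -- A 321 straddling k in position and value has an up-crossing p₁ and a down-crossing p₃;
  -- between them the one-line notation has the shape handled by twice-at-boundary-left/right,
  -- which yields a reduced decomposition of w with two letters σ_k.
  321-gives-two-σk : Has321StraddleBoth w k → Σ (Word m) λ ws → Reduced ws w × 2 ≤ count k ws
  321-gives-two-σk (p₁ , p₂ , p₃ , (p₁<p₂ , p₂<p₃ , w₂<w₁ , w₃<w₂) , (p₁≤K , K<p₃) , (w₃≤K , K<w₁)) =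
    twice-reduced w k (subst (TwiceAt K) (sym (Cut.shape C)) twice-path)
    where
      G : ℕ → ℕ
      G i = toℕ (w ⟨$⟩ʳ clamp m i)
      G-toℕ : ∀ x → G (toℕ x) ≡ toℕ (w ⟨$⟩ʳ x)
      G-toℕ x = cong (λ y → toℕ (w ⟨$⟩ʳ y)) (clamp-toℕ m x)
      left-stays : ∀ {i} → toℕ p₁ < i → i ≤ K → G i ≤ K
      left-stays {i} p₁<i i≤K with G i ≤? K
      ... | yes Gi≤K = Gi≤K
      ... | no  Gi≰K = contradiction (up-crossing-unique {clamp m i} (subst (_≤ K) (sym i≡) i≤K , ≰⇒> Gi≰K)
                                        (p₁≤K , K<w₁)) (λ e → <⇒≢ p₁<i (sym (trans (sym i≡) e)))
        where i≡ = toℕ-clamp m i (≤-trans i≤K (<⇒≤ (Finₚ.toℕ<n k)))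
      right-stays : ∀ {i} → K < i → i < toℕ p₃ → K < G i
      right-stays {i} K<i i<p₃ with G i ≤? K
      ... | no  Gi≰K = ≰⇒> Gi≰K
      ... | yes Gi≤K = contradiction (down-crossing-unique {clamp m i} (subst (K <_) (sym i≡) K<i , Gi≤K)
                                        (K<p₃ , w₃≤K)) (λ e → <⇒≢ i<p₃ (trans (sym i≡) e))
        where i≡ = toℕ-clamp m i (≤-pred (<-trans i<p₃ (Finₚ.toℕ<n p₃)))
      K<a : K < G (toℕ p₁)
      K<a = subst (K <_) (sym (G-toℕ p₁)) K<w₁
      c≤K : G (toℕ p₃) ≤ K
      c≤K = subst (_≤ K) (sym (G-toℕ p₃)) w₃≤K
      C = cut G p₁≤K K<p₃ (Finₚ.toℕ<n p₃)
      open Cut C using (pre; X; Y; rest; lengths; X-all; X-any; Y-all; Y-any)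
      twice-path : TwiceAt K (pre ++ G (toℕ p₁) ∷ X ++ Y ++ G (toℕ p₃) ∷ rest)
      twice-path with toℕ p₂ ≤? K
      ... | yes p₂≤K = twice-at-boundary-left pre X Y rest lengths K<a c≤K (X-all left-stays) (Y-all right-stays)
                         (X-any p₁<p₂ p₂≤K (subst₂ _<_ (sym (G-toℕ p₃)) (sym (G-toℕ p₂)) w₃<w₂))
      ... | no  p₂≰K = twice-at-boundary-right pre X Y rest lengths K<a c≤K (X-all left-stays) (Y-all right-stays)
                         (Y-any (≰⇒> p₂≰K) p₂<p₃ (subst₂ _<_ (sym (G-toℕ p₂)) (sym (G-toℕ p₁)) w₂<w₁))

  no-321 : (∀ ws → Reduced ws w → count k ws ≤ 1) → ¬ Has321StraddleBoth w k
  no-321 at-most-once straddling =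
    let ws , reduced , twice = 321-gives-two-σk straddling in <⇒≱ twice (at-most-once ws reduced)

lemma3p1 : ∀ (m : ℕ) (w : Permutation′ (suc m)) (k : Fin m) →
    MaxIs k w 1 →
    ¬ Has3412StraddlePos w k × ¬ Has3412StraddleVal w k × ¬ Has321StraddleBoth w k
lemma3p1 m w k ((ws , (expresses , _) , once) , at-most-once) with split-at-unique k ws once
... | u , v , refl , u-free , v-free = no-3412-position , no-3412-value , no-321 at-most-once
  where open Crossings w k u v expresses u-free v-free
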